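{- Let $(y_n)_{n\ge 1}$ be a nondecreasing sequence of positive integers with output array $A(n,k)$. Let $n\ge 2$ and let $k$ be an integer with $1\le k\le y_n$. Then $$A(n,k)=A(n-1,k)+A(n,k-1),$$ and also $$A(n,k)=\sum_{j=0}^{k}A(n-1,j).$$
   Context: Let $(y_n)_{n\ge1}$ be a nondecreasing sequence of positive integers (an input sequence). For a positive integer $n$, an $n$-tuple $\mathbf{x}=(x_1,\dots,x_n)$ of nonnegative integers is called valid for $(y_n)$ if $x_1\le y_n$ and $x_{j+1}\le \min(x_j,y_{n-j})$ for $1\le j\le n-1$. For $n\ge1$ and $k\ge0$, $A(n,k)$ denotes the number of valid $n$-tuples with $x_1=k$; the array $(A(n,k))$ (rows indexed by $n$, columns by $k$) is the output array of $(y_n)$. -}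

module Defs where

open import Data.Nat using (ℕ; zero; suc; _≤_; _≤?_; _≟_)
open import Data.Nat.Properties using ()
open import Data.List using (List; []; _∷_; map; concatMap; upTo; filter; length)
open import Data.Vec using (Vec; []; _∷_)
open import Data.Product using (_×_; _,_)
open import Data.Unit using (⊤; tt)
open import Relation.Nullary using (Dec; yes; no)
open import Relation.Nullary.Decidable using (_×-dec_)
open import Relation.Binary.PropositionalEquality using (_≡_)

-- An input sequence is y : ℕ → ℕ, read as (y_n)_{n ≥ 1}; the value y 0 is never used.
NondecreasingPos : (ℕ → ℕ) → Set
NondecreasingPos y =
  (∀ m n → 1 ≤ m → m ≤ n → y m ≤ y n) × (∀ n → 1 ≤ n → 1 ≤ y n)

-- Tail conditions: for the tail (x_{j+1}, ..., x_n) of length m = n - j,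
-- preceded by x_j = p, require x_{j+1} ≤ x_j and x_{j+1} ≤ y_{n-j} = y_m, recursively.
TailValid : (ℕ → ℕ) → (m : ℕ) → ℕ → Vec ℕ m → Set
TailValid y zero p [] = ⊤
TailValid y (suc m) p (x ∷ xs) = (x ≤ p × x ≤ y (suc m)) × TailValid y m x xs

Valid : (ℕ → ℕ) → (n : ℕ) → Vec ℕ n → Set
Valid y zero [] = ⊤
Valid y (suc m) (x ∷ xs) = x ≤ y (suc m) × TailValid y m x xs

ValidWithHead : (ℕ → ℕ) → (n : ℕ) → ℕ → Vec ℕ n → Set
ValidWithHead y zero k xs = Valid y zero xs
ValidWithHead y (suc m) k (x ∷ xs) = Valid y (suc m) (x ∷ xs) × x ≡ k

tailValid? : ∀ y m p (xs : Vec ℕ m) → Dec (TailValid y m p xs)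
tailValid? y zero p [] = yes tt
tailValid? y (suc m) p (x ∷ xs) = ((x ≤? p) ×-dec (x ≤? y (suc m))) ×-dec tailValid? y m x xs

valid? : ∀ y n (xs : Vec ℕ n) → Dec (Valid y n xs)
valid? y zero [] = yes tt
valid? y (suc m) (x ∷ xs) = (x ≤? y (suc m)) ×-dec tailValid? y m x xs

validWithHead? : ∀ y n k (xs : Vec ℕ n) → Dec (ValidWithHead y n k xs)
validWithHead? y zero k xs = valid? y zero xs
validWithHead? y (suc m) k (x ∷ xs) = valid? y (suc m) (x ∷ xs) ×-dec (x ≟ k)

allVecs : ℕ → (n : ℕ) → List (Vec ℕ n)
allVecs B zero = [] ∷ []
allVecs B (suc n) = concatMap (λ x → map (x ∷_) (allVecs B n)) (upTo (suc B))

-- Every entry of a valid n-tuple is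
-- ≤ x_1 ≤ y_n, so enumerating tuples with entries ≤ y_n captures all of them.
-- (A 0 k is defined as 0; the paper only uses n ≥ 1.)
A : (ℕ → ℕ) → ℕ → ℕ → ℕ
A y zero k = 0
A y (suc m) k = length (filter (validWithHead? y (suc m) k) (allVecs (y (suc m)) (suc m)))

{-# OPTIONS --safe #-}
-- A valid n-tuple with head k is k followed by an (n-1)-tuple with head j ≤ k that
-- satisfies exactly the conditions of a valid (n-1)-tuple (x_{i+1} ≤ y_{n-i}).
-- Hence A(n,k) = Σ_{j ≤ k} A(n-1,j) whenever k ≤ y_n (terms with j > y_{n-1}
-- vanish), and peeling off the last term gives the recurrence.  The only
-- technical point is that A counts tuples inside the box [0, y_n]^n.
module Submission where

open import Defs
open import Data.Bool using (true; false; if_then_else_)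
open import Data.Nat using (ℕ; zero; suc; _+_; _∸_; _≤_; _<_; _≤?_; z≤n; s≤s)
open import Data.Nat.Properties
  using (≤-refl; ≤-trans; <⇒≱; <⇒≢; >⇒≢; n≤1+n; m≤n⇒m≤1+n; m≤n⇒m<n∨m≡n; +-comm; +-identityʳ)
open import Data.Nat.ListAction using (sum)
open import Data.Nat.ListAction.Properties using (sum-++)
open import Data.List using (List; []; _∷_; [_]; _++_; map; concatMap; upTo; filter; length)
open import Data.List.Properties using (filter-++; filter-≐; filter-none; length-++; map-++; map-cong; upTo-∷ʳ)
open import Data.List.Relation.Unary.All using (universal)
open import Data.Product using (_×_; _,_; proj₁; proj₂)
open import Data.Sum using (inj₁; inj₂)
open import Data.Vec using (Vec; _∷_)
open import Function using (_∘_)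
open import Level using (Level)
open import Relation.Nullary using (Dec; yes; no; does; ¬_)
open import Relation.Nullary.Decidable using (_×-dec_; dec-true; dec-false)
open import Relation.Unary using (Pred; Decidable)
open import Relation.Binary.PropositionalEquality
  using (_≡_; _≢_; refl; sym; trans; cong; module ≡-Reasoning)
open ≡-Reasoning

∑< : ℕ → (ℕ → ℕ) → ℕ
∑< n f = sum (map f (upTo n))

syntax ∑< n (λ x → f) = ∑[ x < n ] f

∑-suc : ∀ n f → ∑< (suc n) f ≡ ∑< n f + f n
∑-suc n f = begin
  sum (map f (upTo (suc n)))           ≡⟨ cong (sum ∘ map f) (sym (upTo-∷ʳ n)) ⟩
  sum (map f (upTo n ++ [ n ]))        ≡⟨ cong sum (map-++ f (upTo n) [ n ]) ⟩
  sum (map f (upTo n) ++ [ f n ])      ≡⟨ sum-++ (map f (upTo n)) [ f n ] ⟩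
  ∑< n f + (f n + 0)                   ≡⟨ cong (∑< n f +_) (+-identityʳ (f n)) ⟩
  ∑< n f + f n                         ∎

∑-cong-< : ∀ n {f g} → (∀ x → x < n → f x ≡ g x) → ∑< n f ≡ ∑< n g
∑-cong-< zero    f≡g = refl
∑-cong-< (suc n) {f} {g} f≡g = begin
  ∑< (suc n) f   ≡⟨ ∑-suc n f ⟩
  ∑< n f + f n   ≡⟨ cong (_+ f n) (∑-cong-< n (λ x x<n → f≡g x (m≤n⇒m≤1+n x<n))) ⟩
  ∑< n g + f n   ≡⟨ cong (∑< n g +_) (f≡g n ≤-refl) ⟩
  ∑< n g + g n   ≡⟨ sym (∑-suc n g) ⟩
  ∑< (suc n) g   ∎

∑-vanishing-tail : ∀ {m n} f → m ≤ n → (∀ x → m ≤ x → x < n → f x ≡ 0) → ∑< n f ≡ ∑< m f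
∑-vanishing-tail {m} {zero}  f z≤n       _    = refl
∑-vanishing-tail {m} {suc n} f m≤1+n     vanish with m≤n⇒m<n∨m≡n m≤1+n
... | inj₂ refl = refl
... | inj₁ (s≤s m≤n) = begin
  ∑< (suc n) f    ≡⟨ ∑-suc n f ⟩
  ∑< n f + f n    ≡⟨ cong (∑< n f +_) (vanish n m≤n ≤-refl) ⟩
  ∑< n f + 0      ≡⟨ +-identityʳ _ ⟩
  ∑< n f          ≡⟨ ∑-vanishing-tail f m≤n (λ x m≤x x<n → vanish x m≤x (m≤n⇒m≤1+n x<n)) ⟩
  ∑< m f          ∎

∑-single : ∀ {n k} f → k < n → (∀ x → x ≢ k → f x ≡ 0) → ∑< n f ≡ f k
∑-single {n} {k} f k<n vanish = begin
  ∑< n f          ≡⟨ ∑-vanishing-tail f k<n (λ x k<x _ → vanish x (>⇒≢ k<x)) ⟩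
  ∑< (suc k) f    ≡⟨ ∑-suc k f ⟩
  ∑< k f + f k    ≡⟨ cong (_+ f k) (∑-vanishing-tail f z≤n (λ x _ x<k → vanish x (<⇒≢ x<k))) ⟩
  f k             ∎

module _ {a ℓ : Level} {X : Set a} where

  count : {P : Pred X ℓ} → Decidable P → List X → ℕ
  count P? = length ∘ filter P?

  count-++ : ∀ {P : Pred X ℓ} (P? : Decidable P) xs ys → count P? (xs ++ ys) ≡ count P? xs + count P? ys
  count-++ P? xs ys = trans (cong length (filter-++ P? xs ys)) (length-++ (filter P? xs))

  count-none : ∀ {P : Pred X ℓ} (P? : Decidable P) → (∀ x → ¬ P x) → ∀ xs → count P? xs ≡ 0
  count-none P? ¬P xs = cong length (filter-none P? (universal ¬P xs))

  count-const-×-dec : ∀ {Q : Set ℓ} {P : Pred X ℓ} (Q? : Dec Q) (P? : Decidable P) xs →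
                      count (λ x → Q? ×-dec P? x) xs ≡ (if does Q? then count P? xs else 0)
  count-const-×-dec (yes q) P? xs = cong length (filter-≐ _ P? (proj₂ , (q ,_)) xs)
  count-const-×-dec (no ¬q) P? xs = count-none _ (λ _ → ¬q ∘ proj₁) xs

module _ {a b ℓ : Level} {X : Set a} {Y : Set b} {P : Pred Y ℓ} (P? : Decidable P) where

  count-map : ∀ (g : X → Y) xs → count P? (map g xs) ≡ count (P? ∘ g) xs
  count-map g []       = refl
  count-map g (x ∷ xs) with does (P? (g x))
  ... | true  = cong suc (count-map g xs)
  ... | false = count-map g xs

  count-concatMap : ∀ (g : X → List Y) xs → count P? (concatMap g xs) ≡ sum (map (count P? ∘ g) xs)
  count-concatMap g []       = refl
  count-concatMap g (x ∷ xs) =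
    trans (count-++ P? (g x) (concatMap g xs)) (cong (count P? (g x) +_) (count-concatMap g xs))

count-allVecs-suc : ∀ {ℓ} B m {P : Pred (Vec ℕ (suc m)) ℓ} (P? : Decidable P) →
                    count P? (allVecs B (suc m)) ≡ ∑[ x < suc B ] count (P? ∘ (x ∷_)) (allVecs B m)
count-allVecs-suc B m P? = begin
  count P? (concatMap (λ x → map (x ∷_) (allVecs B m)) (upTo (suc B)))
    ≡⟨ count-concatMap P? (λ x → map (x ∷_) (allVecs B m)) (upTo (suc B)) ⟩
  sum (map (λ x → count P? (map (x ∷_) (allVecs B m))) (upTo (suc B)))
    ≡⟨ cong sum (map-cong (λ x → count-map P? (x ∷_) (allVecs B m)) (upTo (suc B))) ⟩
  ∑[ x < suc B ] count (P? ∘ (x ∷_)) (allVecs B m)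
    ∎

module _ (y : ℕ → ℕ) where

  validTails : ℕ → ℕ → ℕ
  validTails zero    p = 1
  validTails (suc m) p = ∑[ x < suc p ] (if does (x ≤? y (suc m)) then validTails m x else 0)

  count-tailValid : ∀ {B} m p → p ≤ B → count (tailValid? y m p) (allVecs B m) ≡ validTails m p
  count-tailValid         zero    p _   = refl
  count-tailValid {B = B} (suc m) p p≤B = begin
    count (tailValid? y (suc m) p) (allVecs B (suc m))
      ≡⟨ count-allVecs-suc B m (tailValid? y (suc m) p) ⟩
    ∑[ x < suc B ] count (λ xs → ((x ≤? p) ×-dec (x ≤? y (suc m))) ×-dec tailValid? y m x xs) (allVecs B m)
      ≡⟨ cong sum (map-cong (λ x → count-const-×-dec ((x ≤? p) ×-dec (x ≤? y (suc m))) (tailValid? y m x) (allVecs B m)) (upTo (suc B))) ⟩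
    ∑[ x < suc B ] term x
      ≡⟨ ∑-vanishing-tail term (s≤s p≤B) beyond ⟩
    ∑[ x < suc p ] term x
      ≡⟨ ∑-cong-< (suc p) within ⟩
    validTails (suc m) p
      ∎
    where
    term : ℕ → ℕ
    term x = if does ((x ≤? p) ×-dec (x ≤? y (suc m))) then count (tailValid? y m x) (allVecs B m) else 0

    beyond : ∀ x → suc p ≤ x → x < suc B → term x ≡ 0
    beyond x p<x _ rewrite dec-false (x ≤? p) (<⇒≱ p<x) = refl

    within : ∀ x → x < suc p → term x ≡ (if does (x ≤? y (suc m)) then validTails m x else 0)
    within x (s≤s x≤p) rewrite dec-true (x ≤? p) x≤p =
      cong (λ c → if does (x ≤? y (suc m)) then c else 0) (count-tailValid m x (≤-trans x≤p p≤B))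

  A-suc : ∀ m k → A y (suc m) k ≡ (if does (k ≤? y (suc m)) then validTails m k else 0)
  A-suc m k with k ≤? y (suc m)
  ... | no k≰B = begin
    A y (suc m) k
      ≡⟨ count-none _ (λ { (x ∷ _) ((x≤B , _) , refl) → k≰B x≤B }) (allVecs (y (suc m)) (suc m)) ⟩
    0
      ≡⟨ cong (if_then validTails m k else 0) (dec-false (k ≤? y (suc m)) k≰B) ⟨
    (if does (k ≤? y (suc m)) then validTails m k else 0)
      ∎
  ... | yes k≤B = begin
    A y (suc m) k
      ≡⟨ count-allVecs-suc B m (validWithHead? y (suc m) k) ⟩
    ∑[ x < suc B ] headed x
      ≡⟨ ∑-single headed (s≤s k≤B) (λ x x≢k → count-none _ (λ _ → x≢k ∘ proj₂) (allVecs B m)) ⟩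
    headed k
      ≡⟨ cong length (filter-≐ _ _ (proj₁ , (_, refl)) (allVecs B m)) ⟩
    count (λ xs → (k ≤? B) ×-dec tailValid? y m k xs) (allVecs B m)
      ≡⟨ count-const-×-dec (k ≤? B) (tailValid? y m k) (allVecs B m) ⟩
    (if does (k ≤? B) then count (tailValid? y m k) (allVecs B m) else 0)
      ≡⟨ cong (λ c → if does (k ≤? B) then c else 0) (count-tailValid m k k≤B) ⟩
    (if does (k ≤? B) then validTails m k else 0)
      ∎
    where
    B : ℕ
    B = y (suc m)

    headed : ℕ → ℕ
    headed x = count (validWithHead? y (suc m) k ∘ (x ∷_)) (allVecs B m)

  A-suc-suc : ∀ m k → k ≤ y (suc (suc m)) → A y (suc (suc m)) k ≡ ∑[ j < suc k ] A y (suc m) j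
  A-suc-suc m k k≤y = begin
    A y (suc (suc m)) k
      ≡⟨ A-suc (suc m) k ⟩
    (if does (k ≤? y (suc (suc m))) then validTails (suc m) k else 0)
      ≡⟨ cong (if_then validTails (suc m) k else 0) (dec-true (k ≤? y (suc (suc m))) k≤y) ⟩
    validTails (suc m) k
      ≡⟨ cong sum (map-cong (λ j → sym (A-suc m j)) (upTo (suc k))) ⟩
    ∑[ j < suc k ] A y (suc m) j
      ∎

corollary2p3 : (y : ℕ → ℕ) → NondecreasingPos y → (n k : ℕ) → 2 ≤ n → 1 ≤ k → k ≤ y n →
    (A y n k ≡ A y (n ∸ 1) k + A y n (k ∸ 1))
    × (A y n k ≡ sum (map (A y (n ∸ 1)) (upTo (k + 1))))
corollary2p3 y _ (suc (suc m)) (suc k) (s≤s (s≤s z≤n)) (s≤s z≤n) k<y = recurrence , partialSum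
  where
  recurrence : A y (suc (suc m)) (suc k) ≡ A y (suc m) (suc k) + A y (suc (suc m)) k
  recurrence = begin
    A y (suc (suc m)) (suc k)                               ≡⟨ A-suc-suc y m (suc k) k<y ⟩
    ∑[ j < suc (suc k) ] A y (suc m) j                      ≡⟨ ∑-suc (suc k) (A y (suc m)) ⟩
    ∑[ j < suc k ] A y (suc m) j + A y (suc m) (suc k)      ≡⟨ +-comm _ (A y (suc m) (suc k)) ⟩
    A y (suc m) (suc k) + ∑[ j < suc k ] A y (suc m) j      ≡⟨ cong (A y (suc m) (suc k) +_) (sym (A-suc-suc y m k (≤-trans (n≤1+n k) k<y))) ⟩
    A y (suc m) (suc k) + A y (suc (suc m)) k               ∎

  partialSum : A y (suc (suc m)) (suc k) ≡ ∑< (suc k + 1) (A y (suc m))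
  partialSum = trans (A-suc-suc y m (suc k) k<y) (cong (λ n → ∑< n (A y (suc m))) (+-comm 1 (suc k)))
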